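{- Let $G,H$ be well-tempered scoring games. If $G\lesssim H$, then $\pi(G)=\pi(H)$.
   Context: A well-tempered scoring game is defined recursively: an even-tempered game is either an integer or a pair $\{G^L|G^R\}$ with finite nonempty sets of odd-tempered left options and right options; an odd-tempered game is a pair $\{G^L|G^R\}$ with finite nonempty sets of even-tempered options. Integers have no options. $\pi(G)=0$ if $G$ is even-tempered and $1$ if odd-tempered. Outcomes: $\operatorname{L}(n)=\operatorname{R}(n)=n$ for integers, otherwise $\operatorname{L}(G)=\max_{G^L}\operatorname{R}(G^L)$, $\operatorname{R}(G)=\min_{G^R}\operatorname{L}(G^R)$. Disjunctive sum: integer sum if both are integers, else $G+H=\{G^L+H,G+H^L\mid G^R+H,G+H^R\}$. $G\lesssim H$ means $\operatorname{L}(G+X)\le\operatorname{L}(H+X)$ and $\operatorname{R}(G+X)\le\operatorname{R}(H+X)$ for every well-tempered scoring game $X$. -}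

module Defs where

open import Data.Nat using (ℕ; zero; suc) renaming (_+_ to _+ℕ_)
open import Data.Fin using (Fin; splitAt)
open import Data.Sum using (_⊎_; inj₁; inj₂; [_,_])
open import Data.Integer using (ℤ; _⊔_; _⊓_) renaming (_+_ to _+ℤ_; _≤_ to _≤ℤ_)
open import Relation.Binary.PropositionalEquality using (_≡_; refl; subst; sym)

data Temper : Set where
  even odd : Temper

flip : Temper → Temper
flip even = odd
flip odd  = even

_⊕_ : Temper → Temper → Temper
even ⊕ q = q
odd  ⊕ q = flip q

⊕-flipˡ : ∀ p q → flip p ⊕ q ≡ flip (p ⊕ q)
⊕-flipˡ even even = refl
⊕-flipˡ even odd  = refl
⊕-flipˡ odd  even = refl
⊕-flipˡ odd  odd  = refl

⊕-flipʳ : ∀ p q → p ⊕ flip q ≡ flip (p ⊕ q)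
⊕-flipʳ even q    = refl
⊕-flipʳ odd  even = refl
⊕-flipʳ odd  odd  = refl

⊕-evenʳ : ∀ p → p ⊕ even ≡ p
⊕-evenʳ even = refl
⊕-evenʳ odd  = refl

data Game : Temper → Set where
  int : ℤ → Game even
  opt : ∀ {p} {m n : ℕ} →
        (Fin (suc m) → Game (flip p)) → (Fin (suc n) → Game (flip p)) → Game p

πT : Temper → ℕ
πT even = 0
πT odd  = 1

π : ∀ {p} → Game p → ℕ
π {p} _ = πT p

maxF : ∀ {m} → (Fin (suc m) → ℤ) → ℤ
maxF {zero}  f = f Fin.zero
maxF {suc m} f = f Fin.zero ⊔ maxF (λ i → f (Fin.suc i))

minF : ∀ {m} → (Fin (suc m) → ℤ) → ℤ
minF {zero}  f = f Fin.zero
minF {suc m} f = f Fin.zero ⊓ minF (λ i → f (Fin.suc i))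

mutual
  Lo : ∀ {p} → Game p → ℤ
  Lo (int n)     = n
  Lo (opt GL GR) = maxF (λ i → Ro (GL i))

  Ro : ∀ {p} → Game p → ℤ
  Ro (int n)     = n
  Ro (opt GL GR) = minF (λ i → Lo (GR i))

infixl 6 _+_
_+_ : ∀ {p q} → Game p → Game q → Game (p ⊕ q)
int a + int b = int (a +ℤ b)
int a + opt HL HR = opt (λ j → int a + HL j) (λ j → int a + HR j)
_+_ {p} (opt GL GR) (int b) =
  subst Game (sym (⊕-evenʳ p)) (opt (λ i → subst Game (⊕-evenʳ (flip p)) (GL i + int b))
                                      (λ i → subst Game (⊕-evenʳ (flip p)) (GR i + int b)))
_+_ {p} {q} (opt {m = m₁} {n = n₁} GL GR) (opt {m = m₂} {n = n₂} HL HR) =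
  opt {m = m₁ +ℕ suc m₂} {n = n₁ +ℕ suc n₂}
    (λ i → [ (λ j → subst Game (⊕-flipˡ p q) (GL j + opt HL HR))
           , (λ j → subst Game (⊕-flipʳ p q) (opt GL GR + HL j)) ] (splitAt (suc m₁) i))
    (λ i → [ (λ j → subst Game (⊕-flipˡ p q) (GR j + opt HL HR))
           , (λ j → subst Game (⊕-flipʳ p q) (opt GL GR + HR j)) ] (splitAt (suc n₁) i))

record _≲_ {p q} (G : Game p) (H : Game q) : Set where
  field
    Lo-≤ : ∀ {r} (X : Game r) → Lo (G + X) ≤ℤ Lo (H + X)
    Ro-≤ : ∀ {r} (X : Game r) → Ro (G + X) ≤ℤ Ro (H + X)

-- Add to G the switch X = {A | B}: taking it scores A for Left or B for Right.
-- Whoever is to move can keep answering in G, so the temper of G decides who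
-- can be forced to take the switch: for even G the player who moves first, for
-- odd G the other one.  With A = min G and B = max H + 1, a comparison G ≲ H
-- between games of different tempers would give min G + B ≤ max H + A.
module Submission where

open import Defs
open import Data.Nat using (zero; suc)
import Data.Nat as ℕ
open import Data.Fin using (Fin; splitAt; _↑ˡ_)
open import Data.Fin.Properties using (splitAt-↑ˡ)
import Data.Fin as Fin
open import Data.Sum using (_⊎_; inj₁; inj₂; [_,_]′)
open import Data.Empty using (⊥-elim)
open import Data.Integer using (ℤ; _⊔_; _⊓_; +_) renaming (suc to sucℤ; _+_ to _+ℤ_; _≤_ to _≤ℤ_)
open import Data.Integer.Properties
open import Relation.Nullary using (¬_)
open import Relation.Binary.PropositionalEquality using (_≡_; refl; module ≡-Reasoning; sym; trans; cong; cong₂; subst)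

maxF-lub : ∀ {m} (f : Fin (suc m) → ℤ) {k} → (∀ i → f i ≤ℤ k) → maxF f ≤ℤ k
maxF-lub {zero}  f f≤k = f≤k Fin.zero
maxF-lub {suc m} f f≤k = ⊔-lub (f≤k Fin.zero) (maxF-lub (λ i → f (Fin.suc i)) (λ i → f≤k (Fin.suc i)))

maxF-ub : ∀ {m} (f : Fin (suc m) → ℤ) i → f i ≤ℤ maxF f
maxF-ub {zero}  f Fin.zero    = ≤-refl
maxF-ub {suc m} f Fin.zero    = i≤i⊔j _ _
maxF-ub {suc m} f (Fin.suc i) = ≤-trans (maxF-ub (λ i → f (Fin.suc i)) i) (i≤j⊔i _ _)

minF-glb : ∀ {m} (f : Fin (suc m) → ℤ) {k} → (∀ i → k ≤ℤ f i) → k ≤ℤ minF f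
minF-glb {zero}  f k≤f = k≤f Fin.zero
minF-glb {suc m} f k≤f = ⊓-glb (k≤f Fin.zero) (minF-glb (λ i → f (Fin.suc i)) (λ i → k≤f (Fin.suc i)))

minF-lb : ∀ {m} (f : Fin (suc m) → ℤ) i → minF f ≤ℤ f i
minF-lb {zero}  f Fin.zero    = ≤-refl
minF-lb {suc m} f Fin.zero    = i⊓j≤i _ _
minF-lb {suc m} f (Fin.suc i) = ≤-trans (i⊓j≤j _ _) (minF-lb (λ i → f (Fin.suc i)) i)

maxF-+ : ∀ {m} (f g : Fin (suc m) → ℤ) c → (∀ i → f i ≡ g i +ℤ c) → maxF f ≡ maxF g +ℤ c
maxF-+ {zero}  f g c f≡g+c = f≡g+c Fin.zero
maxF-+ {suc m} f g c f≡g+c = begin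
  f Fin.zero ⊔ maxF (λ i → f (Fin.suc i))
    ≡⟨ cong₂ _⊔_ (f≡g+c Fin.zero) (maxF-+ (λ i → f (Fin.suc i)) (λ i → g (Fin.suc i)) c (λ i → f≡g+c (Fin.suc i))) ⟩
  (g Fin.zero +ℤ c) ⊔ (maxF (λ i → g (Fin.suc i)) +ℤ c)
    ≡⟨ mono-≤-distrib-⊔ (+-monoˡ-≤ c) (g Fin.zero) (maxF (λ i → g (Fin.suc i))) ⟨
  maxF g +ℤ c ∎
  where open ≡-Reasoning

minF-+ : ∀ {m} (f g : Fin (suc m) → ℤ) c → (∀ i → f i ≡ g i +ℤ c) → minF f ≡ minF g +ℤ c
minF-+ {zero}  f g c f≡g+c = f≡g+c Fin.zero
minF-+ {suc m} f g c f≡g+c = begin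
  f Fin.zero ⊓ minF (λ i → f (Fin.suc i))
    ≡⟨ cong₂ _⊓_ (f≡g+c Fin.zero) (minF-+ (λ i → f (Fin.suc i)) (λ i → g (Fin.suc i)) c (λ i → f≡g+c (Fin.suc i))) ⟩
  (g Fin.zero +ℤ c) ⊓ (minF (λ i → g (Fin.suc i)) +ℤ c)
    ≡⟨ mono-≤-distrib-⊓ (+-monoˡ-≤ c) (g Fin.zero) (minF (λ i → g (Fin.suc i))) ⟨
  minF g +ℤ c ∎
  where open ≡-Reasoning

maxScore : ∀ {p} → Game p → ℤ
maxScore (int a)     = a
maxScore (opt GL GR) = maxF (λ i → maxScore (GL i)) ⊔ maxF (λ i → maxScore (GR i))

minScore : ∀ {p} → Game p → ℤ
minScore (int a)     = a
minScore (opt GL GR) = minF (λ i → minScore (GL i)) ⊓ minF (λ i → minScore (GR i))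

module _ {p m n} (GL : Fin (suc m) → Game (flip p)) (GR : Fin (suc n) → Game (flip p)) where

  maxScore-left : ∀ i → maxScore (GL i) ≤ℤ maxScore (opt {p} GL GR)
  maxScore-left i = ≤-trans (maxF-ub (λ i → maxScore (GL i)) i) (i≤i⊔j _ _)

  maxScore-right : ∀ i → maxScore (GR i) ≤ℤ maxScore (opt {p} GL GR)
  maxScore-right i = ≤-trans (maxF-ub (λ i → maxScore (GR i)) i) (i≤j⊔i _ _)

  minScore-left : ∀ i → minScore (opt {p} GL GR) ≤ℤ minScore (GL i)
  minScore-left i = ≤-trans (i⊓j≤i _ _) (minF-lb (λ i → minScore (GL i)) i)

  minScore-right : ∀ i → minScore (opt {p} GL GR) ≤ℤ minScore (GR i)
  minScore-right i = ≤-trans (i⊓j≤j _ _) (minF-lb (λ i → minScore (GR i)) i)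

mutual
  Lo≤maxScore : ∀ {p} (G : Game p) → Lo G ≤ℤ maxScore G
  Lo≤maxScore (int a)     = ≤-refl
  Lo≤maxScore (opt GL GR) =
    maxF-lub (λ i → Ro (GL i)) (λ i → ≤-trans (Ro≤maxScore (GL i)) (maxScore-left GL GR i))

  Ro≤maxScore : ∀ {p} (G : Game p) → Ro G ≤ℤ maxScore G
  Ro≤maxScore (int a)     = ≤-refl
  Ro≤maxScore (opt GL GR) =
    ≤-trans (minF-lb (λ i → Lo (GR i)) Fin.zero) (≤-trans (Lo≤maxScore (GR Fin.zero)) (maxScore-right GL GR Fin.zero))

mutual
  minScore≤Lo : ∀ {p} (G : Game p) → minScore G ≤ℤ Lo G
  minScore≤Lo (int a)     = ≤-refl
  minScore≤Lo (opt GL GR) =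
    ≤-trans (≤-trans (minScore-left GL GR Fin.zero) (minScore≤Ro (GL Fin.zero))) (maxF-ub (λ i → Ro (GL i)) Fin.zero)

  minScore≤Ro : ∀ {p} (G : Game p) → minScore G ≤ℤ Ro G
  minScore≤Ro (int a)     = ≤-refl
  minScore≤Ro (opt GL GR) =
    minF-glb (λ i → Lo (GR i)) (λ i → ≤-trans (minScore-right GL GR i) (minScore≤Lo (GR i)))

Lo-subst : ∀ {p q} (e : p ≡ q) (G : Game p) → Lo (subst Game e G) ≡ Lo G
Lo-subst refl G = refl

Ro-subst : ∀ {p q} (e : p ≡ q) (G : Game p) → Ro (subst Game e G) ≡ Ro G
Ro-subst refl G = refl

mutual
  Lo-+int : ∀ {p} (G : Game p) c → Lo (G + int c) ≡ Lo G +ℤ c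
  Lo-+int (int a)         c = refl
  Lo-+int {p} (opt GL GR) c = trans (Lo-subst (sym (⊕-evenʳ p)) _)
    (maxF-+ _ _ c (λ i → trans (Ro-subst (⊕-evenʳ (flip p)) (GL i + int c)) (Ro-+int (GL i) c)))

  Ro-+int : ∀ {p} (G : Game p) c → Ro (G + int c) ≡ Ro G +ℤ c
  Ro-+int (int a)         c = refl
  Ro-+int {p} (opt GL GR) c = trans (Ro-subst (sym (⊕-evenʳ p)) _)
    (minF-+ _ _ c (λ i → trans (Lo-subst (⊕-evenʳ (flip p)) (GR i + int c)) (Lo-+int (GR i) c)))

module _ {p q m n m′ n′}
         (GL : Fin (suc m) → Game (flip p)) (GR : Fin (suc n) → Game (flip p))
         (HL : Fin (suc m′) → Game (flip q)) (HR : Fin (suc n′) → Game (flip q)) where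

  private
    G : Game p
    G = opt GL GR

    H : Game q
    H = opt HL HR

    leftCase : Fin (suc m) ⊎ Fin (suc m′) → Game (flip (p ⊕ q))
    leftCase = [ (λ i → subst Game (⊕-flipˡ p q) (GL i + H))
               , (λ j → subst Game (⊕-flipʳ p q) (G + HL j)) ]′

    rightCase : Fin (suc n) ⊎ Fin (suc n′) → Game (flip (p ⊕ q))
    rightCase = [ (λ i → subst Game (⊕-flipˡ p q) (GR i + H))
                , (λ j → subst Game (⊕-flipʳ p q) (G + HR j)) ]′

  Lo-+-lub : ∀ {k} → (∀ i → Ro (GL i + H) ≤ℤ k) → (∀ j → Ro (G + HL j) ≤ℤ k) → Lo (G + H) ≤ℤ k
  Lo-+-lub {k} GL≤ HL≤ = maxF-lub (λ i → Ro (leftCase (splitAt (suc m) i))) bound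
    where
    bound : ∀ i → Ro (leftCase (splitAt (suc m) i)) ≤ℤ k
    bound i with splitAt (suc m) i
    ... | inj₁ i′ = subst (_≤ℤ k) (sym (Ro-subst (⊕-flipˡ p q) _)) (GL≤ i′)
    ... | inj₂ j  = subst (_≤ℤ k) (sym (Ro-subst (⊕-flipʳ p q) _)) (HL≤ j)

  Lo-+-ub : ∀ i → Ro (GL i + H) ≤ℤ Lo (G + H)
  Lo-+-ub i = begin
    Ro (GL i + H)                                  ≡⟨ Ro-subst (⊕-flipˡ p q) (GL i + H) ⟨
    Ro (subst Game (⊕-flipˡ p q) (GL i + H))       ≡⟨ cong (λ s → Ro (leftCase s)) (splitAt-↑ˡ (suc m) i (suc m′)) ⟨
    Ro (leftCase (splitAt (suc m) (i ↑ˡ suc m′)))  ≤⟨ maxF-ub (λ i → Ro (leftCase (splitAt (suc m) i))) (i ↑ˡ suc m′) ⟩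
    Lo (G + H)                                     ∎
    where open ≤-Reasoning

  Ro-+-glb : ∀ {k} → (∀ i → k ≤ℤ Lo (GR i + H)) → (∀ j → k ≤ℤ Lo (G + HR j)) → k ≤ℤ Ro (G + H)
  Ro-+-glb {k} ≤GR ≤HR = minF-glb (λ i → Lo (rightCase (splitAt (suc n) i))) bound
    where
    bound : ∀ i → k ≤ℤ Lo (rightCase (splitAt (suc n) i))
    bound i with splitAt (suc n) i
    ... | inj₁ i′ = subst (k ≤ℤ_) (sym (Lo-subst (⊕-flipˡ p q) _)) (≤GR i′)
    ... | inj₂ j  = subst (k ≤ℤ_) (sym (Lo-subst (⊕-flipʳ p q) _)) (≤HR j)

  Ro-+-lb : ∀ i → Ro (G + H) ≤ℤ Lo (GR i + H)
  Ro-+-lb i = begin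
    Ro (G + H)                                      ≤⟨ minF-lb (λ i → Lo (rightCase (splitAt (suc n) i))) (i ↑ˡ suc n′) ⟩
    Lo (rightCase (splitAt (suc n) (i ↑ˡ suc n′)))  ≡⟨ cong (λ s → Lo (rightCase s)) (splitAt-↑ˡ (suc n) i (suc n′)) ⟩
    Lo (subst Game (⊕-flipˡ p q) (GR i + H))        ≡⟨ Lo-subst (⊕-flipˡ p q) (GR i + H) ⟩
    Lo (GR i + H)                                   ∎
    where open ≤-Reasoning

switch : ℤ → ℤ → Game odd
switch A B = opt {odd} {zero} {zero} (λ _ → int A) (λ _ → int B)

module _ (A B : ℤ) where

  mutual
    Lo-even+switch≤ : (G : Game even) → Lo (G + switch A B) ≤ℤ maxScore G +ℤ A
    Lo-even+switch≤ (int a)       = ≤-refl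
    Lo-even+switch≤ G@(opt GL GR) = Lo-+-lub GL GR _ _
      (λ i → ≤-trans (Ro-odd+switch≤ (GL i)) (+-monoˡ-≤ A (maxScore-left GL GR i)))
      (λ _ → ≤-trans (≤-reflexive (Ro-+int G A)) (+-monoˡ-≤ A (Ro≤maxScore G)))

    ≤Ro-even+switch : (G : Game even) → minScore G +ℤ B ≤ℤ Ro (G + switch A B)
    ≤Ro-even+switch (int a)       = ≤-refl
    ≤Ro-even+switch G@(opt GL GR) = Ro-+-glb GL GR _ _
      (λ i → ≤-trans (+-monoˡ-≤ B (minScore-right GL GR i)) (≤Lo-odd+switch (GR i)))
      (λ _ → ≤-trans (+-monoˡ-≤ B (minScore≤Lo G)) (≤-reflexive (sym (Lo-+int G B))))

    ≤Lo-odd+switch : (G : Game odd) → minScore G +ℤ B ≤ℤ Lo (G + switch A B)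
    ≤Lo-odd+switch (opt GL GR) = ≤-trans
      (≤-trans (+-monoˡ-≤ B (minScore-left GL GR Fin.zero)) (≤Ro-even+switch (GL Fin.zero)))
      (Lo-+-ub GL GR _ _ Fin.zero)

    Ro-odd+switch≤ : (G : Game odd) → Ro (G + switch A B) ≤ℤ maxScore G +ℤ A
    Ro-odd+switch≤ (opt GL GR) = ≤-trans
      (Ro-+-lb GL GR _ _ Fin.zero)
      (≤-trans (Lo-even+switch≤ (GR Fin.zero)) (+-monoˡ-≤ A (maxScore-right GL GR Fin.zero)))

i+suc[j]≰j+i : ∀ i j → ¬ (i +ℤ sucℤ j ≤ℤ j +ℤ i)
i+suc[j]≰j+i i j i+suc[j]≤j+i = i≮i (suc[i]≤j⇒i<j (subst (_≤ℤ j +ℤ i) i+suc[j]≡suc[j+i] i+suc[j]≤j+i))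
  where
  i+suc[j]≡suc[j+i] : i +ℤ sucℤ j ≡ sucℤ (j +ℤ i)
  i+suc[j]≡suc[j+i] = trans (+-comm i (sucℤ j)) (+-assoc (+ 1) j i)

even≴odd : (G : Game even) (H : Game odd) → ¬ G ≲ H
even≴odd G H G≲H = i+suc[j]≰j+i (minScore G) (maxScore H) (begin
  minScore G +ℤ B  ≤⟨ ≤Ro-even+switch A B G ⟩
  Ro (G + X)       ≤⟨ _≲_.Ro-≤ G≲H X ⟩
  Ro (H + X)       ≤⟨ Ro-odd+switch≤ A B H ⟩
  maxScore H +ℤ A  ∎)
  where
  open ≤-Reasoning
  A = minScore G
  B = sucℤ (maxScore H)
  X = switch A B

odd≴even : (G : Game odd) (H : Game even) → ¬ G ≲ H
odd≴even G H G≲H = i+suc[j]≰j+i (minScore G) (maxScore H) (begin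
  minScore G +ℤ B  ≤⟨ ≤Lo-odd+switch A B G ⟩
  Lo (G + X)       ≤⟨ _≲_.Lo-≤ G≲H X ⟩
  Lo (H + X)       ≤⟨ Lo-even+switch≤ A B H ⟩
  maxScore H +ℤ A  ∎)
  where
  open ≤-Reasoning
  A = minScore G
  B = sucℤ (maxScore H)
  X = switch A B

mainTheorem5 : ∀ {p q} (G : Game p) (H : Game q) → G ≲ H → π G ≡ π H
mainTheorem5 {even} {even} G H G≲H = refl
mainTheorem5 {odd}  {odd}  G H G≲H = refl
mainTheorem5 {even} {odd}  G H G≲H = ⊥-elim (even≴odd G H G≲H)
mainTheorem5 {odd}  {even} G H G≲H = ⊥-elim (odd≴even G H G≲H)
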